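{- Let $\mathbf v$ be a complementary symmetric Rote sequence starting with the letter $0$, associated with a standard Sturmian sequence $\mathbf u=\mathcal S(\mathbf v)$. Let $x$ be a non-empty prefix of $\mathbf v$ and $w=\mathcal S(x)$; let $r,s$ be the return words to $w$ in $\mathbf u$ with $r$ the more frequent one, and $k$ the positive integer such that $\mathbf u$ is a concatenation of blocks $r^ks$ and $r^{k+1}s$. Then the prefix $x$ of $\mathbf v$ has three return words $A,B,C\in\{0,1\}^+$ satisfying: (i) if $w$ is of type $SU(k)$, then $\mathcal S(A0)=r$, $\mathcal S(B0)=sr^{k+1}s$ and $\mathcal S(C0)=sr^ks$; (ii) if $w$ is of type $US(k)$, then $\mathcal S(A0)=rr$, $\mathcal S(B0)=rsr$ and $\mathcal S(C0)=s$; (iii) if $w$ is of type $UU(k)$, then $\mathcal S(A0)=rr$, $\mathcal S(B0)=rs$ and $\mathcal S(C0)=sr$.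
   Context: A Sturmian sequence is a sequence over $\{0,1\}$ with factor complexity $n+1$ for all $n$; it is standard if $0\mathbf u$ and $1\mathbf u$ are both Sturmian. A complementary symmetric Rote sequence is a sequence over $\{0,1\}$ with factor complexity $2n$ for $n\ge1$ whose set of factors is closed under $0\leftrightarrow1$; it is associated with the Sturmian sequence $\mathcal S(\mathbf v)$, where for words $v_0\cdots v_n$, $\mathcal S(v_0\cdots v_n)=u_0\cdots u_{n-1}$ with $u_i=v_i+v_{i+1}\bmod2$, and analogously for sequences. Throughout, Rote sequences are taken to start with $0$. A return word to a prefix $w$ of $\mathbf u=u_0u_1\cdots$ is $u_i\cdots u_{j-1}$ for consecutive occurrences $i<j$ of $w$. Every prefix $w$ of a standard Sturmian sequence $\mathbf u$ has exactly two return words $r,s$ ($r$ more frequent), and $\mathbf u$ is a concatenation of blocks $r^ks$ and $r^{k+1}s$ for a unique positive integer $k$. A word is stable if it contains an even number of letters $1$, unstable otherwise. The prefix $w$ is of type $SU(k)$ if $r$ is stable and $s$ unstable, of type $US(k)$ if $r$ is unstable and $s$ stable, and of type $UU(k)$ if both are unstable (the case of both stable does not occur). -}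

module Defs where

open import Data.Bool using (Bool; true; false; not; _xor_)
open import Data.Nat using (ℕ; zero; suc; _+_; _*_; _∸_; _<_; _≤_; _%_)
open import Data.List using (List; []; _∷_; _++_; length; map; replicate; concat)
open import Data.List.Relation.Unary.All using (All)
open import Data.List.Relation.Unary.Unique.Propositional using (Unique)
open import Data.List.Membership.Propositional using (_∈_)
open import Data.Product using (Σ; ∃; _×_; _,_)
open import Data.Sum using (_⊎_)
open import Relation.Binary.PropositionalEquality using (_≡_)
open import Relation.Nullary using (¬_)

-- Letters: 0 = false, 1 = true.  Words are lists, infinite sequences are ℕ → Bool.
Word : Set
Word = List Bool

Seq : Set
Seq = ℕ → Bool

factor : Seq → ℕ → ℕ → Word
factor u i zero    = []
factor u i (suc n) = u i ∷ factor u (suc i) n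

OccursAt : Seq → Word → ℕ → Set
OccursAt u w i = factor u i (length w) ≡ w

IsFactor : Seq → Word → Set
IsFactor u w = ∃ λ i → OccursAt u w i

IsPrefix : Word → Seq → Set
IsPrefix w u = OccursAt u w 0

_◃_ : Bool → Seq → Seq
(a ◃ u) zero    = a
(a ◃ u) (suc n) = u n

HasComplexity : Seq → ℕ → ℕ → Set
HasComplexity u n m =
  Σ (List Word) λ L →
    length L ≡ m × Unique L × All (λ z → length z ≡ n × IsFactor u z) L
    × (∀ z → length z ≡ n → IsFactor u z → z ∈ L)

Sturmian : Seq → Set
Sturmian u = ∀ n → HasComplexity u n (suc n)

StandardSturmian : Seq → Set
StandardSturmian u = Sturmian (false ◃ u) × Sturmian (true ◃ u)

CSRote : Seq → Set
CSRote v = (∀ n → 1 ≤ n → HasComplexity v n (2 * n))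
         × (∀ z → IsFactor v z → IsFactor v (map not z))

Sw : Word → Word
Sw []            = []
Sw (a ∷ [])      = []
Sw (a ∷ b ∷ t)   = (a xor b) ∷ Sw (b ∷ t)

Ss : Seq → Seq
Ss v n = v n xor v (suc n)

IsReturnWord : Seq → Word → Word → Set
IsReturnWord u w z =
  ∃ λ i → ∃ λ j → i < j × OccursAt u w i × OccursAt u w j
    × (∀ l → i < l → l < j → ¬ OccursAt u w l)
    × z ≡ factor u i (j ∸ i)

count1 : Word → ℕ
count1 []          = 0
count1 (true ∷ t)  = suc (count1 t)
count1 (false ∷ t) = count1 t

Stable : Word → Set
Stable w = count1 w % 2 ≡ 0

Unstable : Word → Set
Unstable w = count1 w % 2 ≡ 1

_^w_ : Word → ℕ → Word
w ^w n = concat (replicate n w)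

BlockDecomposition : Seq → Word → Word → ℕ → Set
BlockDecomposition u r s k =
  Σ (ℕ → ℕ) λ p → p 0 ≡ 0 ×
    (∀ i → ∃ λ b → (b ≡ (r ^w k) ++ s ⊎ b ≡ (r ^w suc k) ++ s)
                  × p (suc i) ≡ p i + length b
                  × OccursAt u b (p i))

module Submission where

-- Write u = S v and w = S x.  As x begins with 0, x occurs in v at t exactly when w occurs
-- in u at t and v t = 0; and reading a word y in u from position t changes the value of v
-- by the parity of y.  The occurrences of w in u are exactly the starting points of the
-- r's and s's of the block decomposition, so a return word A to x spans a product of r's
-- and s's that starts and ends where v is 0 and meets v = 1 at every boundary in between:
-- along S(A0) the parity of the product read so far first becomes even at its end.  Which
-- products occur is dictated by the parities of r and s: r and s r^j s (j = k, k+1) for SU;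
-- rr, rsr and s for US; rr, rs and sr for UU.  They all do occur, because both exponents k
-- and k+1 keep recurring (otherwise 0u would be eventually periodic, hence not Sturmian)
-- and because complement symmetry moves any occurrence to one where v is 0.  Both r and s
-- stable is impossible: v would vanish at every occurrence of w, yet complement symmetry
-- provides an occurrence where v is 1.

open import Defs
open import Data.Bool using (Bool; true; false; not; _xor_; if_then_else_)
open import Data.Bool.Properties
  using (xor-assoc; xor-same; xor-identityʳ; xor-annihilates-not; not-involutive; ¬-not; not-¬)
  renaming (_≟_ to Bool-≟)
open import Data.Empty using (⊥; ⊥-elim)
open import Data.List using (List; []; _∷_; _++_; length; map; filter; concat; replicate)
open import Data.List.Properties
  using (∷-injective; length-++; length-map; filter-all; ≡-dec; ++-assoc; ++-identityʳ; ++-identityˡ-unique;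
         ++-conicalˡ; ++-cancelˡ; ++-cancelʳ; concat-++; ++-monoid)
open import Data.List.Relation.Unary.All as All using (All; []; _∷_)
open import Data.List.Relation.Unary.All.Properties as All using (all-filter; filter⁺)
open import Data.List.Relation.Unary.AllPairs using ([]; _∷_)
open import Data.List.Relation.Unary.Unique.Propositional using (Unique)
open import Data.List.Relation.Unary.Unique.Propositional.Properties as Unique using ()
open import Data.Nat using (ℕ; zero; suc; _+_; _∸_; _<_; _≤_; _%_; z≤n; s≤s; _⊔_)
open import Data.Nat.DivMod using ([m+n]%n≡m%n)
open import Data.Nat.Induction using (<-rec)
open import Data.Nat.Properties
open import Data.Nat.Tactic.RingSolver using (solve-∀)
open import Data.Product using (∃; _×_; _,_; proj₁; proj₂)
open import Data.Sum using (_⊎_; inj₁; inj₂)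
open import Function.Base using (_∘_)
open import Function.Bundles using (_⇔_; mk⇔; Equivalence)
open import Relation.Binary.Definitions using (DecidableEquality; tri<; tri≈; tri>)
open import Relation.Binary.PropositionalEquality
open import Relation.Nullary using (¬_; Dec; yes; no; ¬?)
open import Relation.Nullary.Decidable using (decidable-stable)
open import Tactic.MonoidSolver using (solve)

-- Factors and occurrences

length-factor : ∀ u t n → length (factor u t n) ≡ n
length-factor u t zero    = refl
length-factor u t (suc n) = cong suc (length-factor u (suc t) n)

occursAt-factor : ∀ u t n → OccursAt u (factor u t n) t
occursAt-factor u t n = cong (factor u t) (length-factor u t n)

occursAt-≡ : ∀ {u t y y'} → y ≡ y' → OccursAt u y t → OccursAt u y' t
occursAt-≡ refl o = o

factor-+ : ∀ (u : Seq) t m n → factor u t (m + n) ≡ factor u t m ++ factor u (t + m) n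
factor-+ u t zero    n rewrite +-identityʳ t = refl
factor-+ u t (suc m) n rewrite +-suc t m = cong (u t ∷_) (factor-+ u (suc t) m n)

occursAt-++⁺ : ∀ {u t} y y' → OccursAt u y t → OccursAt u y' (t + length y) →
               OccursAt u (y ++ y') t
occursAt-++⁺ {u} {t} y y' oy oy' = begin
  factor u t (length (y ++ y'))                  ≡⟨ cong (factor u t) (length-++ y) ⟩
  factor u t (length y + length y')              ≡⟨ factor-+ u t (length y) (length y') ⟩
  factor u t (length y) ++ factor u (t + length y) (length y') ≡⟨ cong₂ _++_ oy oy' ⟩
  y ++ y'                                        ∎
  where open ≡-Reasoning

occursAt-++⁻ : ∀ {u t} y y' → OccursAt u (y ++ y') t →
               OccursAt u y t × OccursAt u y' (t + length y)
occursAt-++⁻ {u} {t} []      y' o = refl , subst (OccursAt u y') (sym (+-identityʳ t)) o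
occursAt-++⁻ {u} {t} (a ∷ y) y' o with ∷-injective o
... | uₜ≡a , o' with occursAt-++⁻ y y' o'
...   | oy , oy' = cong₂ _∷_ uₜ≡a oy , subst (OccursAt u y') (sym (+-suc t (length y))) oy'

occursAt-++ˡ : ∀ {u t} y y' → OccursAt u (y ++ y') t → OccursAt u y t
occursAt-++ˡ y y' o = proj₁ (occursAt-++⁻ y y' o)

occursAt-++ʳ : ∀ {u t} y y' → OccursAt u (y ++ y') t → OccursAt u y' (t + length y)
occursAt-++ʳ y y' o = proj₂ (occursAt-++⁻ y y' o)

factor-≡⇒letter-≡ : ∀ u t t' n → factor u t n ≡ factor u t' n →
                    ∀ o → o < n → u (t + o) ≡ u (t' + o)
factor-≡⇒letter-≡ u t t' (suc n) eq zero    _ =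
  subst₂ (λ i j → u i ≡ u j) (sym (+-identityʳ t)) (sym (+-identityʳ t')) (proj₁ (∷-injective eq))
factor-≡⇒letter-≡ u t t' (suc n) eq (suc o) (s≤s o<n) =
  subst₂ (λ i j → u i ≡ u j) (sym (+-suc t o)) (sym (+-suc t' o))
    (factor-≡⇒letter-≡ u (suc t) (suc t') n (proj₂ (∷-injective eq)) o o<n)

letter-≡⇒factor-≡ : ∀ u a b n → (∀ o → o < n → u (a + o) ≡ u (b + o)) →
                    factor u a n ≡ factor u b n
letter-≡⇒factor-≡ u a b zero    _ = refl
letter-≡⇒factor-≡ u a b (suc n) h = cong₂ _∷_
  (subst₂ (λ i j → u i ≡ u j) (+-identityʳ a) (+-identityʳ b) (h 0 (s≤s z≤n)))
  (letter-≡⇒factor-≡ u (suc a) (suc b) n λ o o<n →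
     subst₂ (λ i j → u i ≡ u j) (+-suc a o) (+-suc b o) (h (suc o) (s≤s o<n)))

occurrences-agree : ∀ {u t t'} y → OccursAt u y t → OccursAt u y t' →
                    ∀ o → o < length y → u (t + o) ≡ u (t' + o)
occurrences-agree {u} {t} {t'} y o o' = factor-≡⇒letter-≡ u t t' (length y) (trans o (sym o'))

occursAt-transport : ∀ {u t i} Y x l → OccursAt u Y t → OccursAt u Y i →
                     l + length x ≤ length Y → OccursAt u x (t + l) → OccursAt u x (i + l)
occursAt-transport {u} {t} {i} Y x l oₜ oᵢ inside o =
  trans (letter-≡⇒factor-≡ u (i + l) (t + l) (length x) same) o
  where
  same : ∀ o → o < length x → u (i + l + o) ≡ u (t + l + o)
  same o o<x = subst₂ (λ a b → u a ≡ u b) (sym (+-assoc i l o)) (sym (+-assoc t l o))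
    (occurrences-agree Y oᵢ oₜ (l + o) (≤-trans (+-monoʳ-< l o<x) inside))

occursAt-prefix : ∀ {u t} x y → OccursAt u x t → OccursAt u y t → length x ≤ length y →
                  ∃ λ e → y ≡ x ++ e
occursAt-prefix {u} {t} x y oₓ o_y x≤y = rest , (begin
  y                                              ≡⟨ sym o_y ⟩
  factor u t (length y)                          ≡⟨ cong (factor u t) (sym (m+[n∸m]≡n x≤y)) ⟩
  factor u t (length x + (length y ∸ length x))  ≡⟨ factor-+ u t (length x) _ ⟩
  factor u t (length x) ++ rest                  ≡⟨ cong (_++ rest) oₓ ⟩
  x ++ rest                                      ∎)
  where
  open ≡-Reasoning
  rest : Word
  rest = factor u (t + length x) (length y ∸ length x)

length-<⇒≢ : ∀ {A : Set} {y y' : List A} → length y < length y' → y ≢ y'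
length-<⇒≢ y<y' y≡y' = <-irrefl (cong length y≡y') y<y'

++-≡⇒prefix : ∀ {A : Set} (a b c d : List A) → a ++ b ≡ c ++ d → length c ≤ length a →
              ∃ λ e → a ≡ c ++ e
++-≡⇒prefix a       b []      d _         _         = a , refl
++-≡⇒prefix (x ∷ a) b (y ∷ c) d eq (s≤s c≤a) with ∷-injective eq
... | refl , eq' with ++-≡⇒prefix a b c d eq' c≤a
...   | e , a≡ce = e , cong (x ∷_) a≡ce

^w-+ : ∀ z m n → z ^w (m + n) ≡ z ^w m ++ z ^w n
^w-+ z zero    n = refl
^w-+ z (suc m) n = trans (cong (z ++_) (^w-+ z m n)) (sym (++-assoc z (z ^w m) (z ^w n)))

locate-in-power : ∀ (z : Word) n b t → b ≤ t → t < b + length (z ^w n) →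
  ∃ λ c → ∃ λ d → c + suc d ≡ n × b + length (z ^w c) ≤ t × t < b + length (z ^w c) + length z
locate-in-power z zero    b t b≤t t<b+0 = ⊥-elim (<⇒≱ t<b+0 (subst (_≤ t) (sym (+-identityʳ b)) b≤t))
locate-in-power z (suc n) b t b≤t t<end with t <? b + length z
... | yes t<b+z = 0 , n , refl , subst (_≤ t) (sym (+-identityʳ b)) b≤t ,
                  subst (λ q → t < q + length z) (sym (+-identityʳ b)) t<b+z
... | no t≮b+z with locate-in-power z n (b + length z) t (≮⇒≥ t≮b+z)
                      (subst (t <_) (trans (cong (b +_) (length-++ z)) (sym (+-assoc b _ _))) t<end)
...   | c , d , c+1+d≡n , lo , hi = suc c , d , cong suc c+1+d≡n ,
                                    subst (_≤ t) shift lo , subst (λ q → t < q + length z) shift hi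
  where
  shift : b + length z + length (z ^w c) ≡ b + length (z ^w suc c)
  shift = trans (+-assoc b _ _) (cong (b +_) (sym (length-++ z)))

-- Parity of words

par : Word → Bool
par []      = false
par (a ∷ y) = a xor par y

par-++ : ∀ y y' → par (y ++ y') ≡ par y xor par y'
par-++ []      y' = refl
par-++ (a ∷ y) y' = trans (cong (a xor_) (par-++ y y')) (sym (xor-assoc a (par y) (par y')))

par-^w : ∀ z c → par z ≡ false → par (z ^w c) ≡ false
par-^w z zero    _  = refl
par-^w z (suc c) pz = trans (par-++ z (z ^w c)) (cong₂ _xor_ pz (par-^w z c pz))

odd : ℕ → Bool
odd zero    = false
odd (suc n) = not (odd n)

%2-odd : ∀ n → n % 2 ≡ (if odd n then 1 else 0)
%2-odd zero          = refl
%2-odd (suc zero)    = refl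
%2-odd (suc (suc n)) = begin
  (2 + n) % 2                       ≡⟨ cong (_% 2) (+-comm 2 n) ⟩
  (n + 2) % 2                       ≡⟨ [m+n]%n≡m%n n 2 ⟩
  n % 2                             ≡⟨ %2-odd n ⟩
  (if odd n then 1 else 0)          ≡⟨ cong (λ b → if b then 1 else 0) (sym (not-involutive (odd n))) ⟩
  (if odd (suc (suc n)) then 1 else 0) ∎
  where open ≡-Reasoning

odd-count1 : ∀ y → odd (count1 y) ≡ par y
odd-count1 []          = refl
odd-count1 (true ∷ y)  = cong not (odd-count1 y)
odd-count1 (false ∷ y) = odd-count1 y

count1-%2 : ∀ y → count1 y % 2 ≡ (if par y then 1 else 0)
count1-%2 y = trans (%2-odd (count1 y)) (cong (λ b → if b then 1 else 0) (odd-count1 y))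

Stable⇒par≡false : ∀ y → Stable y → par y ≡ false
Stable⇒par≡false y st with par y | count1-%2 y
... | false | _  = refl
... | true  | eq with trans (sym st) eq
...   | ()

Unstable⇒par≡true : ∀ y → Unstable y → par y ≡ true
Unstable⇒par≡true y ust with par y | count1-%2 y
... | true  | _  = refl
... | false | eq with trans (sym ust) eq
...   | ()

Stable⇒par≢true : ∀ y → Stable y → par y ≢ true
Stable⇒par≢true y st = not-¬ (Stable⇒par≡false y st)

Unstable⇒par≢false : ∀ y → Unstable y → par y ≢ false
Unstable⇒par≢false y ust = not-¬ (Unstable⇒par≡true y ust)

-- The map S and its inverse

xor-cancelˡ : ∀ a b → a xor (a xor b) ≡ b
xor-cancelˡ a b = trans (sym (xor-assoc a a b)) (cong (_xor b) (xor-same a))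

xor-cancelʳ : ∀ a b → (a xor b) xor b ≡ a
xor-cancelʳ a b = trans (xor-assoc a b b) (trans (cong (a xor_) (xor-same b)) (xor-identityʳ a))

length-Sw : ∀ a y → length (Sw (a ∷ y)) ≡ length y
length-Sw a []      = refl
length-Sw a (b ∷ y) = cong suc (length-Sw b y)

Sw-factor : ∀ v t n → Sw (factor v t (suc n)) ≡ factor (Ss v) t n
Sw-factor v t zero    = refl
Sw-factor v t (suc n) = cong (_ ∷_) (Sw-factor v (suc t) n)

Sw-map-not : ∀ y → Sw (map not y) ≡ Sw y
Sw-map-not []          = refl
Sw-map-not (a ∷ [])    = refl
Sw-map-not (a ∷ b ∷ y) = cong₂ _∷_ (xor-annihilates-not a b) (Sw-map-not (b ∷ y))

Sw-cancel : ∀ a y y' → length y ≡ length y' → Sw (a ∷ y) ≡ Sw (a ∷ y') → y ≡ y'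
Sw-cancel a []      []        _   _  = refl
Sw-cancel a (b ∷ y) (b' ∷ y') len eq with ∷-injective eq
... | ab≡ab' , rest with trans (sym (xor-cancelˡ a b)) (trans (cong (a xor_) ab≡ab') (xor-cancelˡ a b'))
...   | refl = cong (b ∷_) (Sw-cancel b y y' (suc-injective len) rest)

Ss-parity : ∀ v t n → v (t + n) ≡ v t xor par (factor (Ss v) t n)
Ss-parity v t zero    = trans (cong v (+-identityʳ t)) (sym (xor-identityʳ (v t)))
Ss-parity v t (suc n) = begin
  v (t + suc n)                                    ≡⟨ cong v (+-suc t n) ⟩
  v (suc t + n)                                    ≡⟨ Ss-parity v (suc t) n ⟩
  v (suc t) xor p                                  ≡⟨ sym (xor-cancelˡ (v t) _) ⟩
  v t xor (v t xor (v (suc t) xor p))              ≡⟨ cong (v t xor_) (sym (xor-assoc (v t) (v (suc t)) p)) ⟩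
  v t xor par (factor (Ss v) t (suc n))            ∎
  where
  open ≡-Reasoning
  p : Bool
  p = par (factor (Ss v) (suc t) n)

occursAt-Ss-parity : ∀ v {t} y → OccursAt (Ss v) y t → v (t + length y) ≡ v t xor par y
occursAt-Ss-parity v {t} y o = trans (Ss-parity v t (length y)) (cong (λ q → v t xor par q) o)

occursAt-Ss : ∀ v a x t → OccursAt v (a ∷ x) t ⇔ (v t ≡ a × OccursAt (Ss v) (Sw (a ∷ x)) t)
occursAt-Ss v a x t = mk⇔ to from
  where
  lengths : length (Sw (a ∷ x)) ≡ length x
  lengths = length-Sw a x
  to : OccursAt v (a ∷ x) t → v t ≡ a × OccursAt (Ss v) (Sw (a ∷ x)) t
  to o = proj₁ (∷-injective o) ,
         subst (λ n → factor (Ss v) t n ≡ Sw (a ∷ x)) (sym lengths)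
           (trans (sym (Sw-factor v t (length x))) (cong Sw o))
  from : v t ≡ a × OccursAt (Ss v) (Sw (a ∷ x)) t → OccursAt v (a ∷ x) t
  from (vₜ≡a , o) = cong₂ _∷_ vₜ≡a (Sw-cancel a _ x (length-factor v (suc t) (length x)) (begin
    Sw (a ∷ factor v (suc t) (length x))   ≡⟨ cong (λ b → Sw (b ∷ _)) (sym vₜ≡a) ⟩
    Sw (factor v t (suc (length x)))       ≡⟨ Sw-factor v t (length x) ⟩
    factor (Ss v) t (length x)             ≡⟨ subst (λ n → factor (Ss v) t n ≡ Sw (a ∷ x)) lengths o ⟩
    Sw (a ∷ x)                             ∎))
    where open ≡-Reasoning

Sw-factor-snoc : ∀ v t n → Sw (factor v t n ++ v (t + n) ∷ []) ≡ factor (Ss v) t n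
Sw-factor-snoc v t n = begin
  Sw (factor v t n ++ factor v (t + n) 1)  ≡⟨ cong Sw (sym (factor-+ v t n 1)) ⟩
  Sw (factor v t (n + 1))                  ≡⟨ cong (λ m → Sw (factor v t m)) (+-comm n 1) ⟩
  Sw (factor v t (suc n))                  ≡⟨ Sw-factor v t n ⟩
  factor (Ss v) t n                        ∎
  where open ≡-Reasoning

S⁻¹ : Word → Word
S⁻¹ []      = []
S⁻¹ (b ∷ y) = par (b ∷ y) ∷ S⁻¹ y

S⁻¹-spec : ∀ y → Sw (S⁻¹ y ++ false ∷ []) ≡ y
S⁻¹-spec []          = refl
S⁻¹-spec (b ∷ [])    = cong (_∷ []) (xor-cancelʳ b false)
S⁻¹-spec (b ∷ c ∷ y) = cong₂ _∷_ (xor-cancelʳ b (par (c ∷ y))) (S⁻¹-spec (c ∷ y))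

par-Sw-++0 : ∀ d a → par (Sw (d ∷ a ++ false ∷ [])) ≡ d
par-Sw-++0 d []      = xor-cancelʳ d false
par-Sw-++0 d (e ∷ a) = trans (cong ((d xor e) xor_) (par-Sw-++0 e a)) (xor-cancelʳ d e)

S⁻¹-unique : ∀ a → S⁻¹ (Sw (a ++ false ∷ [])) ≡ a
S⁻¹-unique []          = refl
S⁻¹-unique (c ∷ [])    = cong (_∷ []) (xor-cancelʳ c false)
S⁻¹-unique (c ∷ d ∷ a) =
  cong₂ _∷_ (trans (cong ((c xor d) xor_) (par-Sw-++0 d a)) (xor-cancelʳ c d)) (S⁻¹-unique (d ∷ a))

S⁻¹-injective : ∀ y y' → S⁻¹ y ≡ S⁻¹ y' → y ≡ y'
S⁻¹-injective y y' eq =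
  trans (sym (S⁻¹-spec y)) (trans (cong (λ a → Sw (a ++ false ∷ [])) eq) (S⁻¹-spec y'))

factor≡S⁻¹ : ∀ v {t} y → OccursAt (Ss v) y t → v (t + length y) ≡ false →
             factor v t (length y) ≡ S⁻¹ y
factor≡S⁻¹ v {t} y o end≡0 = begin
  factor v t (length y)                                       ≡⟨ sym (S⁻¹-unique _) ⟩
  S⁻¹ (Sw (factor v t (length y) ++ false ∷ []))
    ≡⟨ cong (λ b → S⁻¹ (Sw (factor v t (length y) ++ b ∷ []))) (sym end≡0) ⟩
  S⁻¹ (Sw (factor v t (length y) ++ v (t + length y) ∷ []))
    ≡⟨ cong S⁻¹ (trans (Sw-factor-snoc v t (length y)) o) ⟩
  S⁻¹ y                                                       ∎
  where open ≡-Reasoning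

complement-occurrence : ∀ {v} → (∀ z → IsFactor v z → IsFactor v (map not z)) →
  ∀ {y t} b → OccursAt (Ss v) y t → ∃ λ t' → OccursAt (Ss v) y t' × v t' ≡ b
complement-occurrence {v} closed {y} {t} b o with Bool-≟ (v t) b
... | yes vₜ≡b = t , o , vₜ≡b
... | no vₜ≢b with closed (factor v t (suc (length y))) (t , occursAt-factor v t (suc (length y)))
...   | t' , o' = t' , o-y , trans (proj₁ (∷-injective o-F)) (sym (¬-not (vₜ≢b ∘ sym)))
  where
  F : Word
  F = factor v t (suc (length y))
  o-F : factor v t' (suc (length y)) ≡ map not F
  o-F = subst (λ m → factor v t' m ≡ map not F) (trans (length-map not F) (length-factor v t _)) o'
  o-y : OccursAt (Ss v) y t'
  o-y = begin
    factor (Ss v) t' (length y)       ≡⟨ sym (Sw-factor v t' (length y)) ⟩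
    Sw (factor v t' (suc (length y))) ≡⟨ cong Sw o-F ⟩
    Sw (map not F)                    ≡⟨ Sw-map-not F ⟩
    Sw F                              ≡⟨ Sw-factor v t (length y) ⟩
    factor (Ss v) t (length y)        ≡⟨ o ⟩
    y                                 ∎
    where open ≡-Reasoning

-- Return words

Consecutive : Seq → Word → ℕ → ℕ → Set
Consecutive u w i j =
  i < j × OccursAt u w i × OccursAt u w j × (∀ l → i < l → l < j → ¬ OccursAt u w l)

consecutive-unique : ∀ {u w i j j'} → Consecutive u w i j → Consecutive u w i j' → j ≡ j'
consecutive-unique {j = j} {j'} (i<j , _ , oⱼ , gap) (i<j' , _ , oⱼ' , gap') with <-cmp j j'
... | tri< j<j' _ _ = ⊥-elim (gap' j i<j j<j' oⱼ)
... | tri≈ _ j≡j' _ = j≡j'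
... | tri> _ _ j'<j = ⊥-elim (gap j' i<j' j'<j oⱼ')

consecutive⇒returnWord : ∀ {u w i j} → Consecutive u w i j → IsReturnWord u w (factor u i (j ∸ i))
consecutive⇒returnWord {i = i} {j} (i<j , oᵢ , oⱼ , gap) = i , j , i<j , oᵢ , oⱼ , gap , refl

Returning : Word → Word → Set
Returning w y = ∃ λ e → y ++ w ≡ w ++ e

module _ {w : Word} where

  returning-[] : Returning w []
  returning-[] = [] , sym (++-identityʳ w)

  returning-++ : ∀ y y' → Returning w y → Returning w y' → Returning w (y ++ y')
  returning-++ y y' (e , y-ret) (e' , y'-ret) = e ++ e' , (begin
    (y ++ y') ++ w   ≡⟨ ++-assoc y y' w ⟩
    y ++ (y' ++ w)   ≡⟨ cong (y ++_) y'-ret ⟩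
    y ++ (w ++ e')   ≡⟨ sym (++-assoc y w e') ⟩
    (y ++ w) ++ e'   ≡⟨ cong (_++ e') y-ret ⟩
    (w ++ e) ++ e'   ≡⟨ ++-assoc w e e' ⟩
    w ++ e ++ e'     ∎)
    where open ≡-Reasoning

  returning-^w : ∀ y n → Returning w y → Returning w (y ^w n)
  returning-^w y zero    _     = returning-[]
  returning-^w y (suc n) y-ret = returning-++ y (y ^w n) y-ret (returning-^w y n y-ret)

  returning-concat : ∀ {P : Word → Set} → (∀ {y} → P y → Returning w y) →
                     ∀ {ys} → All P ys → Returning w (concat ys)
  returning-concat ret []             = returning-[]
  returning-concat ret {y ∷ ys} (py ∷ pys) = returning-++ y (concat ys) (ret py) (returning-concat ret pys)

  returning-long : ∀ y → Returning w y → length w ≤ length y → ∃ λ e → y ≡ w ++ e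
  returning-long y (e , y-ret) = ++-≡⇒prefix y w w e y-ret

  module _ {u : Seq} where

    occursAt-returning : ∀ {t} y → Returning w y → OccursAt u (y ++ w) t → OccursAt u w t
    occursAt-returning y (e , y-ret) o = occursAt-++ˡ w e (subst (λ q → OccursAt u q _) y-ret o)

    occursAt-drop-returning : ∀ {t} y g → Returning w g → OccursAt u (y ++ g ++ w) t → OccursAt u (y ++ w) t
    occursAt-drop-returning y g g-ret o =
      occursAt-++⁺ y w (occursAt-++ˡ y _ o) (occursAt-returning g g-ret (occursAt-++ʳ y _ o))

record ReturnWordFacts (u : Seq) (w z : Word) : Set where
  field
    nonempty  : 0 < length z
    returning : Returning w z
    occurs    : ∃ λ t → OccursAt u (z ++ w) t
    gap       : ∀ {t t'} → OccursAt u (z ++ w) t → t < t' → t' < t + length z → ¬ OccursAt u w t'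

returnWord-facts : ∀ {u w z} → IsReturnWord u w z → ReturnWordFacts u w z
returnWord-facts {u} {w} {z} (i , j , i<j , oᵢ , oⱼ , gapᵢⱼ , z≡) = record
  { nonempty  = subst (0 <_) (sym |z|≡j∸i) (m<n⇒0<n∸m i<j)
  ; returning = occursAt-prefix w (z ++ w) oᵢ o-zw (subst (length w ≤_) (sym (length-++ z)) (m≤n+m _ _))
  ; occurs    = i , o-zw
  ; gap       = gap
  }
  where
  |z|≡j∸i : length z ≡ j ∸ i
  |z|≡j∸i = trans (cong length z≡) (length-factor u i (j ∸ i))
  i+|z|≡j : i + length z ≡ j
  i+|z|≡j = trans (cong (i +_) |z|≡j∸i) (m+[n∸m]≡n (<⇒≤ i<j))
  o-zw : OccursAt u (z ++ w) i
  o-zw = occursAt-++⁺ z w (trans (cong (factor u i) |z|≡j∸i) (sym z≡))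
                          (subst (OccursAt u w) (sym i+|z|≡j) oⱼ)
  gap : ∀ {t t'} → OccursAt u (z ++ w) t → t < t' → t' < t + length z → ¬ OccursAt u w t'
  gap {t} {t'} o t<t' t'<t+|z| o' =
    gapᵢⱼ (i + l) (m<m+n i (m<n⇒0<n∸m t<t')) (subst (i + l <_) i+|z|≡j (+-monoʳ-< i l<|z|))
      (occursAt-transport (z ++ w) w l o o-zw
        (≤-trans (+-monoˡ-≤ (length w) (<⇒≤ l<|z|)) (≤-reflexive (sym (length-++ z))))
        (subst (OccursAt u w) (sym t+l≡t') o'))
    where
    l : ℕ
    l = t' ∸ t
    t+l≡t' : t + l ≡ t'
    t+l≡t' = m+[n∸m]≡n (<⇒≤ t<t')
    l<|z| : l < length z
    l<|z| = +-cancelˡ-< t l (length z) (subst (_< t + length z) (sym t+l≡t') t'<t+|z|)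

-- Factor complexity and periodicity

module _ {A : Set} (_≟_ : DecidableEquality A) (f : ℕ → A) where

  private
    length≤1+filter : ∀ c (L : List A) → Unique L →
                      length L ≤ suc (length (filter (λ z → ¬? (z ≟ c)) L))
    length≤1+filter c []      _           = z≤n
    length≤1+filter c (z ∷ L) (z∉L ∷ uL) with z ≟ c
    ... | yes refl = s≤s (≤-reflexive (sym (cong length
                       (filter-all (λ z → ¬? (z ≟ c)) (All.map (λ z≢c c≡z → z≢c (sym c≡z)) z∉L)))))
    ... | no _     = s≤s (length≤1+filter c L uL)

  unique-enumerated⇒length≤ : ∀ m (L : List A) → Unique L →
                              All (λ z → ∃ λ t → t < m × z ≡ f t) L → length L ≤ m
  unique-enumerated⇒length≤ zero    []      _  _                  = z≤n
  unique-enumerated⇒length≤ zero    (_ ∷ _) _  ((_ , () , _) ∷ _)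
  unique-enumerated⇒length≤ (suc m) L       uL enum = ≤-trans (length≤1+filter (f m) L uL)
    (s≤s (unique-enumerated⇒length≤ m _ (Unique.filter⁺ P? uL)
            (All.zipWith shrink (all-filter P? L , filter⁺ P? enum))))
    where
    P? : (z : A) → Dec (¬ z ≡ f m)
    P? z = ¬? (z ≟ f m)
    shrink : ∀ {z} → ¬ z ≡ f m × (∃ λ t → t < suc m × z ≡ f t) → ∃ λ t → t < m × z ≡ f t
    shrink (z≢fm , t , t<1+m , z≡ft) with m≤n⇒m<n∨m≡n (≤-pred t<1+m)
    ... | inj₁ t<m  = t , t<m , z≡ft
    ... | inj₂ refl = ⊥-elim (z≢fm z≡ft)

Word-≟ : DecidableEquality Word
Word-≟ = ≡-dec Bool-≟

factors-occur-before : ∀ {a n m} → HasComplexity a n m →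
  ∃ λ M → ∀ z → length z ≡ n → IsFactor a z → ∃ λ t → t ≤ M × OccursAt a z t
factors-occur-before {a} (L , _ , _ , factorsL , complete) with bound L (All.map proj₂ factorsL)
  where
  bound : ∀ L → All (IsFactor a) L → ∃ λ M → All (λ z → ∃ λ t → t ≤ M × OccursAt a z t) L
  bound []      []              = 0 , []
  bound (z ∷ L) ((t , o) ∷ fsL) with bound L fsL
  ... | M , bsL = t ⊔ M , (t , m≤m⊔n t M , o)
                        ∷ All.map (λ { (t' , t'≤M , o') → t' , ≤-trans t'≤M (m≤n⊔m t M) , o' }) bsL
... | M , bsL = M , λ z lz fz → All.lookup bsL (complete z lz fz)

complexity≤window : ∀ {a n m} K → HasComplexity a n m →
  (∀ z → length z ≡ n → IsFactor a z → ∃ λ t → t < K × z ≡ factor a t n) → m ≤ K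
complexity≤window {a} {n} K (L , lenL , uniqueL , factorsL , _) early =
  subst (_≤ K) lenL (unique-enumerated⇒length≤ Word-≟ (λ t → factor a t n) K L uniqueL
    (All.map (λ {z} (lz , fz) → early z lz fz) factorsL))

module _ (a : Seq) {A P B : ℕ} (0<P : 0 < P)
         (periodic : ∀ y → A ≤ y → y + P < B → a (y + P) ≡ a y) where

  factor-shift-period : ∀ n y → A ≤ y → y + P + n ≤ B → factor a (y + P) n ≡ factor a y n
  factor-shift-period zero    y _   _  = refl
  factor-shift-period (suc n) y A≤y le = cong₂ _∷_
    (periodic y A≤y (≤-trans (s≤s (m≤m+n (y + P) n)) le'))
    (factor-shift-period n (suc y) (m≤n⇒m≤1+n A≤y) le')
    where
    le' : suc (y + P + n) ≤ B
    le' = subst (_≤ B) (+-suc (y + P) n) le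

  factor-in-first-period : ∀ n t → t + n ≤ B → ∃ λ t' → t' < A + P × factor a t n ≡ factor a t' n
  factor-in-first-period n = <-rec Early step
    where
    one-period-back : ∀ {t} → A + P ≤ t → ∃ λ t₀ → A ≤ t₀ × t₀ + P ≡ t
    one-period-back {t} A+P≤t =
      t ∸ P , +-cancelʳ-≤ P A (t ∸ P) (subst (A + P ≤_) (sym t∸P+P≡t) A+P≤t) , t∸P+P≡t
      where
      t∸P+P≡t : t ∸ P + P ≡ t
      t∸P+P≡t = m∸n+n≡m (≤-trans (m≤n+m P A) A+P≤t)
    Early : ℕ → Set
    Early t = t + n ≤ B → ∃ λ t' → t' < A + P × factor a t n ≡ factor a t' n
    step : ∀ t → (∀ {t₀} → t₀ < t → Early t₀) → Early t
    step t rec le with t <? A + P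
    ... | yes t<A+P = t , t<A+P , refl
    ... | no t≮A+P with one-period-back (≮⇒≥ t≮A+P)
    ...   | t₀ , A≤t₀ , refl with rec (m<m+n t₀ 0<P) (≤-trans (+-monoˡ-≤ n (m≤m+n t₀ P)) le)
    ...     | t' , t'<A+P , eq = t' , t'<A+P , trans (factor-shift-period n t₀ A≤t₀ le) eq

module StrictlyIncreasing (f : ℕ → ℕ) (f-< : ∀ i → f i < f (suc i)) where

  f-mono-≤ : ∀ {i j} → i ≤ j → f i ≤ f j
  f-mono-≤ {j = zero}  z≤n   = ≤-refl
  f-mono-≤ {j = suc j} i≤1+j with m≤n⇒m<n∨m≡n i≤1+j
  ... | inj₁ i<1+j = ≤-trans (f-mono-≤ (≤-pred i<1+j)) (<⇒≤ (f-< j))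
  ... | inj₂ refl  = ≤-refl

  f<f⇒< : ∀ {i j} → f i < f j → i < j
  f<f⇒< {i} {j} fi<fj with i <? j
  ... | yes i<j = i<j
  ... | no i≮j  = ⊥-elim (<⇒≱ fi<fj (f-mono-≤ (≮⇒≥ i≮j)))

  n≤f : ∀ i → i ≤ f i
  n≤f zero    = z≤n
  n≤f (suc i) = ≤-trans (s≤s (n≤f i)) (f-< i)

  locate : f 0 ≡ 0 → ∀ t → ∃ λ i → f i ≤ t × t < f (suc i)
  locate f0≡0 zero = 0 , ≤-reflexive f0≡0 , subst (_< f 1) f0≡0 (f-< 0)
  locate f0≡0 (suc t) with locate f0≡0 t
  ... | i , fi≤t , t<fi+1 with m≤n⇒m<n∨m≡n t<fi+1
  ...   | inj₁ 1+t<fi+1 = i , m≤n⇒m≤1+n fi≤t , 1+t<fi+1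
  ...   | inj₂ 1+t≡fi+1 =
    suc i , ≤-reflexive (sym 1+t≡fi+1) , subst (_< f (suc (suc i))) (sym 1+t≡fi+1) (f-< (suc i))

-- Return words of w in the block decomposition of u

record Blocks (u : Seq) (r s : Word) (k : ℕ) : Set where
  field
    start        : ℕ → ℕ
    exponent     : ℕ → ℕ
    start-0      : start 0 ≡ 0
    exponent-k   : ∀ i → exponent i ≡ k ⊎ exponent i ≡ suc k
    start-suc    : ∀ i → start (suc i) ≡ start i + length (r ^w exponent i ++ s)
    block-occurs : ∀ i → OccursAt u (r ^w exponent i ++ s) (start i)

blockDecomposition⇒blocks : ∀ {u r s k} → BlockDecomposition u r s k → Blocks u r s k
blockDecomposition⇒blocks {u} {r} {s} {k} (p , p0≡0 , blocks) = record
  { start        = p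
  ; exponent     = λ i → proj₁ (normal i)
  ; start-0      = p0≡0
  ; exponent-k   = λ i → proj₁ (proj₂ (normal i))
  ; start-suc    = λ i → proj₁ (proj₂ (proj₂ (normal i)))
  ; block-occurs = λ i → proj₂ (proj₂ (proj₂ (normal i)))
  }
  where
  normal : ∀ i → ∃ λ e → (e ≡ k ⊎ e ≡ suc k) × p (suc i) ≡ p i + length (r ^w e ++ s)
                         × OccursAt u (r ^w e ++ s) (p i)
  normal i with blocks i
  ... | _ , inj₁ refl , p-step , o = k     , inj₁ refl , p-step , o
  ... | _ , inj₂ refl , p-step , o = suc k , inj₂ refl , p-step , o

module ReturnsInBlocks
  (u : Seq) (w r s : Word) (k : ℕ)
  (returns : ∀ z → IsReturnWord u w z ⇔ (z ≡ r ⊎ z ≡ s))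
  (1≤k : 1 ≤ k) (blocks : Blocks u r s k) where

  open Blocks blocks public

  Occ : ℕ → Set
  Occ = OccursAt u w

  Ret : Word → Set
  Ret z = z ≡ r ⊎ z ≡ s

  r-ret : Ret r
  r-ret = inj₁ refl

  s-ret : Ret s
  s-ret = inj₂ refl

  ret-facts : ∀ {z} → Ret z → ReturnWordFacts u w z
  ret-facts {z} = returnWord-facts ∘ Equivalence.from (returns z)

  open module RetFacts {z} (ret : Ret z) = ReturnWordFacts (ret-facts ret) public

  ret-pinned : ∀ {z t t'} → Ret z → OccursAt u (z ++ w) t → t ≤ t' → t' < t + length z → Occ t' →
               t' ≡ t
  ret-pinned ret o t≤t' t'<end o' with m≤n⇒m<n∨m≡n t≤t'
  ... | inj₁ t<t' = ⊥-elim (gap ret o t<t' t'<end o')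
  ... | inj₂ t≡t' = sym t≡t'

  ret-unique-at : ∀ {z z' t} → Ret z → Ret z' → OccursAt u (z ++ w) t → OccursAt u (z' ++ w) t → z ≡ z'
  ret-unique-at {z} {z'} {t} ret ret' o o' with <-cmp (length z) (length z')
  ... | tri< z<z' _ _ = ⊥-elim (gap ret' o' (m<m+n t (nonempty ret)) (+-monoʳ-< t z<z') (occursAt-++ʳ z w o))
  ... | tri≈ _ z≡z' _ =
    trans (sym (occursAt-++ˡ z w o)) (trans (cong (factor u t) z≡z') (occursAt-++ˡ z' w o'))
  ... | tri> _ _ z'<z = ⊥-elim (gap ret o (m<m+n t (nonempty ret')) (+-monoʳ-< t z'<z) (occursAt-++ʳ z' w o'))

  block : ℕ → Word
  block i = r ^w exponent i ++ s

  slot : ℕ → ℕ → ℕ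
  slot i c = start i + length (r ^w c)

  exponent-suc : ∀ i → ∃ λ e → exponent i ≡ suc e
  exponent-suc i with exponent-k i
  ... | inj₁ eᵢ≡k  = k ∸ 1 , trans eᵢ≡k (sym (m+[n∸m]≡n 1≤k))
  ... | inj₂ eᵢ≡1+k = k , eᵢ≡1+k

  powers-s-returning : ∀ e → Returning w (r ^w e ++ s)
  powers-s-returning e = returning-++ (r ^w e) s (returning-^w r e (returning r-ret)) (returning s-ret)

  block-returning : ∀ i → Returning w (block i)
  block-returning i = powers-s-returning (exponent i)

  block-nonempty : ∀ i → 0 < length (block i)
  block-nonempty i =
    ≤-trans (nonempty s-ret) (subst (length s ≤_) (sym (length-++ (r ^w exponent i))) (m≤n+m _ _))

  start-< : ∀ i → start i < start (suc i)
  start-< i = subst (start i <_) (sym (start-suc i)) (m<m+n (start i) (block-nonempty i))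

  open StrictlyIncreasing start start-<

  blocks-from : ℕ → ℕ → Word
  blocks-from i zero    = []
  blocks-from i (suc m) = block i ++ blocks-from (suc i) m

  blocks-from-occurs : ∀ m i → OccursAt u (blocks-from i m) (start i)
  blocks-from-occurs zero    i = refl
  blocks-from-occurs (suc m) i = occursAt-++⁺ (block i) _ (block-occurs i)
    (subst (OccursAt u (blocks-from (suc i) m)) (start-suc i) (blocks-from-occurs m (suc i)))

  blocks-from-returning : ∀ m i → Returning w (blocks-from i m)
  blocks-from-returning zero    i = returning-[]
  blocks-from-returning (suc m) i = returning-++ (block i) _ (block-returning i) (blocks-from-returning m (suc i))

  length-blocks-from : ∀ m i → m ≤ length (blocks-from i m)
  length-blocks-from zero    i = z≤n
  length-blocks-from (suc m) i =
    subst (suc m ≤_) (sym (length-++ (block i))) (+-mono-≤ (block-nonempty i) (length-blocks-from m (suc i)))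

  occurs-at-start : ∀ i → Occ (start i)
  occurs-at-start i
    with returning-long (blocks-from i (length w)) (blocks-from-returning (length w) i)
                        (length-blocks-from (length w) i)
  ... | e , blocks≡we = occursAt-++ˡ w e (occursAt-≡ blocks≡we (blocks-from-occurs (length w) i))

  two-blocks : ∀ i → OccursAt u (block i ++ block (suc i) ++ w) (start i)
  two-blocks i = occursAt-++⁺ (block i) _ (block-occurs i)
    (subst (OccursAt u (block (suc i) ++ w)) (start-suc i)
      (occursAt-++⁺ (block (suc i)) w (block-occurs (suc i))
        (subst Occ (start-suc (suc i)) (occurs-at-start (suc (suc i))))))

  block-split : ∀ i c d → c + d ≡ exponent i → block i ≡ r ^w c ++ r ^w d ++ s
  block-split i c d c+d≡e = trans (cong (λ e → r ^w e ++ s) (sym c+d≡e))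
                              (trans (cong (_++ s) (^w-+ r c d)) (++-assoc (r ^w c) (r ^w d) s))

  powers-at-start : ∀ i c d → c + d ≡ exponent i → OccursAt u (r ^w c) (start i)
  powers-at-start i c d c+d≡e = occursAt-++ˡ (r ^w c) _ (occursAt-≡ (block-split i c d c+d≡e) (block-occurs i))

  after-slot : ∀ i c d → c + d ≡ exponent i → OccursAt u (r ^w d ++ s ++ block (suc i) ++ w) (slot i c)
  after-slot i c d c+d≡e = occursAt-++ʳ (r ^w c) _ (occursAt-≡ split (two-blocks i))
    where
    split : block i ++ block (suc i) ++ w ≡ r ^w c ++ r ^w d ++ s ++ block (suc i) ++ w
    split = trans (cong (_++ block (suc i) ++ w) (block-split i c d c+d≡e)) (solve (++-monoid Bool))

  rest-returning : ∀ i d → Returning w (r ^w d ++ s ++ block (suc i))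
  rest-returning i d = returning-++ (r ^w d) _ (returning-^w r d (returning r-ret))
                         (returning-++ s _ (returning s-ret) (block-returning (suc i)))

  block-suc : ∀ i → ∃ λ e → block i ≡ r ++ r ^w e ++ s
  block-suc i with exponent-suc i
  ... | e , eᵢ≡1+e = e , trans (cong (λ n → r ^w n ++ s) eᵢ≡1+e) (++-assoc r (r ^w e) s)

  at-slot : ∀ i c d y g → c + d ≡ exponent i → Returning w g →
            r ^w d ++ s ++ block (suc i) ++ w ≡ y ++ g ++ w → OccursAt u (y ++ w) (slot i c)
  at-slot i c d y g c+d≡e g-ret split =
    occursAt-drop-returning y g g-ret (occursAt-≡ split (after-slot i c d c+d≡e))

  r-at-slot : ∀ i c d → c + suc d ≡ exponent i → OccursAt u (r ++ w) (slot i c)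
  r-at-slot i c d c+1+d≡e =
    at-slot i c (suc d) r (r ^w d ++ s ++ block (suc i)) c+1+d≡e (rest-returning i d) (solve (++-monoid Bool))

  rr-at-slot : ∀ i c d → c + suc (suc d) ≡ exponent i → OccursAt u ((r ++ r) ++ w) (slot i c)
  rr-at-slot i c d c+2+d≡e =
    at-slot i c (2 + d) (r ++ r) (r ^w d ++ s ++ block (suc i)) c+2+d≡e (rest-returning i d)
      (solve (++-monoid Bool))

  rs-at-slot : ∀ i c → c + 1 ≡ exponent i → OccursAt u ((r ++ s) ++ w) (slot i c)
  rs-at-slot i c c+1≡e =
    at-slot i c 1 (r ++ s) (block (suc i)) c+1≡e (block-returning (suc i)) (solve (++-monoid Bool))

  s-at-slot : ∀ i → OccursAt u (s ++ w) (slot i (exponent i))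
  s-at-slot i = at-slot i (exponent i) 0 s (block (suc i)) (+-identityʳ _) (block-returning (suc i)) refl

  s-powers-s-at-slot : ∀ i {j} → exponent (suc i) ≡ j →
                       OccursAt u ((s ++ r ^w j ++ s) ++ w) (slot i (exponent i))
  s-powers-s-at-slot i refl =
    at-slot i (exponent i) 0 (s ++ block (suc i)) [] (+-identityʳ _) returning-[] (solve (++-monoid Bool))

  rsr-at-slot : ∀ i c → c + 1 ≡ exponent i → OccursAt u ((r ++ s ++ r) ++ w) (slot i c)
  rsr-at-slot i c c+1≡e with block-suc (suc i)
  ... | e , block≡ = at-slot i c 1 (r ++ s ++ r) (r ^w e ++ s) c+1≡e
                       (powers-s-returning e)
                       (trans (cong (λ b → (r ++ []) ++ s ++ b ++ w) block≡) (solve (++-monoid Bool)))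

  sr-at-slot : ∀ i → OccursAt u ((s ++ r) ++ w) (slot i (exponent i))
  sr-at-slot i with block-suc (suc i)
  ... | e , block≡ = at-slot i (exponent i) 0 (s ++ r) (r ^w e ++ s) (+-identityʳ _)
                       (powers-s-returning e)
                       (trans (cong (λ b → s ++ b ++ w) block≡) (solve (++-monoid Bool)))

  occurrence⇒slot : ∀ {t} → Occ t → ∃ λ i → ∃ λ c → ∃ λ d → c + d ≡ exponent i × t ≡ slot i c
  occurrence⇒slot {t} o with locate start-0 t
  ... | i , startᵢ≤t , t<startᵢ₊₁ with t <? start i + length (r ^w exponent i)
  ...   | yes in-powers with locate-in-power r (exponent i) (start i) t startᵢ≤t in-powers
  ...     | c , d , c+1+d≡e , slot≤t , t<slot+r =
              i , c , suc d , c+1+d≡e , ret-pinned r-ret (r-at-slot i c d c+1+d≡e) slot≤t t<slot+r o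
  occurrence⇒slot {t} o | i , startᵢ≤t , t<startᵢ₊₁ | no not-in-powers =
    i , exponent i , 0 , +-identityʳ _ , ret-pinned s-ret (s-at-slot i) (≮⇒≥ not-in-powers) t<slot+s o
    where
    t<slot+s : t < slot i (exponent i) + length s
    t<slot+s = subst (t <_) (trans (start-suc i) (trans (cong (start i +_) (length-++ (r ^w exponent i)))
                                                   (sym (+-assoc (start i) _ _)))) t<startᵢ₊₁

  constant-run⇒periodic : ∀ c N → (∀ i → i < N → exponent (suc i) ≡ c) →
    ∀ y → start 1 ≤ y → y + length (r ^w c ++ s) < start (suc N) → u (y + length (r ^w c ++ s)) ≡ u y
  constant-run⇒periodic c N run y start₁≤y y+P<end with locate start-0 y
  ... | zero  , _  , y<start₁ = ⊥-elim (<⇒≱ y<start₁ start₁≤y)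
  ... | suc i , lo , hi with m≤n⇒∃[o]m+o≡n lo
  ...   | o , refl = begin
    u (t + o + P)   ≡⟨ cong u (+-right-comm t o P) ⟩
    u (t + P + o)   ≡⟨ occurrences-agree b (subst (OccursAt u b) next≡t+P second) first o o<P ⟩
    u (t + o)       ∎
    where
    open ≡-Reasoning
    b : Word
    b = r ^w c ++ s
    P : ℕ
    P = length b
    t : ℕ
    t = start (suc i)
    block-at : ∀ j → j < N → OccursAt u b (start (suc j))
    block-at j j<N = subst (λ e → OccursAt u (r ^w e ++ s) (start (suc j))) (run j j<N) (block-occurs (suc j))
    i<N : i < N
    i<N = <-pred (f<f⇒< (≤-<-trans lo (≤-<-trans (m≤m+n (t + o) P) y+P<end)))
    first : OccursAt u b t
    first = block-at i i<N
    next≡t+P : start (suc (suc i)) ≡ t + P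
    next≡t+P = trans (start-suc (suc i)) (cong (λ e → t + length (r ^w e ++ s)) (run i i<N))
    second : OccursAt u b (start (suc (suc i)))
    second = block-at (suc i)
      (<-pred (f<f⇒< (≤-<-trans (≤-trans (≤-reflexive next≡t+P) (+-monoˡ-≤ P (m≤m+n t o))) y+P<end)))
    o<P : o < P
    o<P = +-cancelˡ-< t o P (subst (t + o <_) next≡t+P hi)
    +-right-comm : ∀ a b c → a + b + c ≡ a + c + b
    +-right-comm = solve-∀

  module _ (sturmian : Sturmian (false ◃ u)) (c : ℕ) where

    private
      P : ℕ
      P = length (r ^w c ++ s)
      A : ℕ
      A = suc (start 1)
      n : ℕ
      n = A + P

    -- Were blocks 1, …, N all of exponent c, 0u would have period P on a window holding an
    -- occurrence of each of its factors of length n, leaving at most n such factors.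
    exponent-varies : ∃ λ i → exponent (suc i) ≢ c
    exponent-varies with factors-occur-before (sturmian n)
    ... | M , early with anyUpTo? (λ i → ¬? (exponent (suc i) ≟ c)) (M + n)
    ...   | yes (i , _ , eᵢ≢c) = i , eᵢ≢c
    ...   | no none = ⊥-elim (1+n≰n (complexity≤window n (sturmian n) in-first-period))
      where
      N : ℕ
      N = M + n
      B : ℕ
      B = suc (start (suc N))
      run : ∀ i → i < N → exponent (suc i) ≡ c
      run i i<N = decidable-stable (exponent (suc i) ≟ c) (λ eᵢ≢c → none (i , i<N , eᵢ≢c))
      periodic : ∀ y → A ≤ y → y + P < B → (false ◃ u) (y + P) ≡ (false ◃ u) y
      periodic (suc y) (s≤s start₁≤y) (s≤s y+P<end) = constant-run⇒periodic c N run y start₁≤y y+P<end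
      0<P : 0 < P
      0<P = ≤-trans (nonempty s-ret) (subst (length s ≤_) (sym (length-++ (r ^w c))) (m≤n+m _ _))
      N≤B : N ≤ B
      N≤B = ≤-trans (n≤1+n N) (≤-trans (n≤f (suc N)) (n≤1+n _))
      in-first-period : ∀ z → length z ≡ n → IsFactor (false ◃ u) z →
                        ∃ λ t → t < n × z ≡ factor (false ◃ u) t n
      in-first-period z |z|≡n fz with early z |z|≡n fz
      ... | t , t≤M , o
        with factor-in-first-period (false ◃ u) 0<P periodic n t (≤-trans (+-monoˡ-≤ n t≤M) N≤B)
      ...   | t' , t'<n , same =
        t' , t'<n , trans (sym (subst (λ m → factor (false ◃ u) t m ≡ z) |z|≡n o)) same

  exponent-k-recurs : Sturmian (false ◃ u) → ∃ λ i → exponent (suc i) ≡ k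
  exponent-k-recurs sturmian with exponent-varies sturmian (suc k)
  ... | i , eᵢ₊₁≢1+k with exponent-k (suc i)
  ...   | inj₁ eᵢ₊₁≡k   = i , eᵢ₊₁≡k
  ...   | inj₂ eᵢ₊₁≡1+k = ⊥-elim (eᵢ₊₁≢1+k eᵢ₊₁≡1+k)

  exponent-1+k-recurs : Sturmian (false ◃ u) → ∃ λ i → exponent (suc i) ≡ suc k
  exponent-1+k-recurs sturmian with exponent-varies sturmian k
  ... | i , eᵢ₊₁≢k with exponent-k (suc i)
  ...   | inj₁ eᵢ₊₁≡k   = ⊥-elim (eᵢ₊₁≢k eᵢ₊₁≡k)
  ...   | inj₂ eᵢ₊₁≡1+k = i , eᵢ₊₁≡1+k

  s≢r++r : r ≢ s → s ≢ r ++ r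
  s≢r++r r≢s s≡rr with occurs s-ret
  ... | t , o = r≢s (ret-unique-at r-ret s-ret (occursAt-drop-returning r r (returning r-ret) o') o)
    where
    o' : OccursAt u (r ++ r ++ w) t
    o' = occursAt-≡ (trans (cong (_++ w) s≡rr) (++-assoc r r w)) o

  r++s≢s++r : r ≢ s → r ++ s ≢ s ++ r
  r++s≢s++r r≢s rs≡sr with exponent-suc 0
  ... | e , e₀≡1+e = r≢s (ret-unique-at r-ret s-ret
                           (occursAt-drop-returning r s (returning s-ret) (occursAt-≡ (++-assoc r s w) o))
                           (occursAt-drop-returning s r (returning r-ret)
                             (occursAt-≡ (trans (cong (_++ w) rs≡sr) (++-assoc s r w)) o)))
    where
    o : OccursAt u ((r ++ s) ++ w) (slot 0 e)
    o = rs-at-slot 0 e (trans (+-comm e 1) (sym e₀≡1+e))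

-- Lifting to the Rote sequence

HasReturnWords : Seq → Word → Word → Word → Word → Set → Set
HasReturnWords v x A B C P = A ≢ [] × B ≢ [] × C ≢ [] × A ≢ B × A ≢ C × B ≢ C
                             × (∀ z → IsReturnWord v x z ⇔ (z ≡ A ⊎ z ≡ B ⊎ z ≡ C)) × P

module LiftToRote
  (v : Seq) (complement-closed : ∀ z → IsFactor v z → IsFactor v (map not z)) (v₀≡0 : v 0 ≡ false)
  (sturmian : Sturmian (false ◃ Ss v)) (x' r s : Word) (k : ℕ) (r≢s : r ≢ s)
  (returns : ∀ z → IsReturnWord (Ss v) (Sw (false ∷ x')) z ⇔ (z ≡ r ⊎ z ≡ s))
  (1≤k : 1 ≤ k) (blocks : Blocks (Ss v) r s k) where

  open ReturnsInBlocks (Ss v) (Sw (false ∷ x')) r s k returns 1≤k blocks public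

  x : Word
  x = false ∷ x'

  u : Seq
  u = Ss v

  w : Word
  w = Sw x

  x-occurs : ∀ {t} → OccursAt v x t → v t ≡ false × Occ t
  x-occurs {t} = Equivalence.to (occursAt-Ss v false x' t)

  occurs-x : ∀ {t} → v t ≡ false → Occ t → OccursAt v x t
  occurs-x {t} vₜ≡0 o = Equivalence.from (occursAt-Ss v false x' t) (vₜ≡0 , o)

  -- b is the value of v where zs starts.
  OddThenEven : Bool → List Word → Set
  OddThenEven b []       = b ≡ false
  OddThenEven b (z ∷ zs) = b ≡ true × OddThenEven (b xor par z) zs

  ReturnPattern : Word → Set
  ReturnPattern y = ∃ λ z → ∃ λ zs → Ret z × All Ret zs × z ++ concat zs ≡ y × OddThenEven (par z) zs

  concat-returning : ∀ {zs} → All Ret zs → Returning w (concat zs)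
  concat-returning = returning-concat {P = Ret} returning

  return-step : ∀ {z t} y → Ret z → Returning w y → OccursAt u ((z ++ y) ++ w) t →
                OccursAt u (z ++ w) t × OccursAt u (y ++ w) (t + length z) × v (t + length z) ≡ v t xor par z
  return-step {z} {t} y ret y-ret o =
    occursAt-++⁺ z w (occursAt-++ˡ z _ o') (occursAt-returning y y-ret next) , next ,
    occursAt-Ss-parity v z (occursAt-++ˡ z _ o')
    where
    o' : OccursAt u (z ++ y ++ w) t
    o' = occursAt-≡ (++-assoc z y w) o
    next : OccursAt u (y ++ w) (t + length z)
    next = occursAt-++ʳ z _ o'

  skip-return : ∀ {z t e} → Ret z → OccursAt u (z ++ w) t →
                (∀ l → t + length z ≤ l → l < e → Occ l → v l ≡ true) →
                ∀ l → t < l → l < e → Occ l → v l ≡ true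
  skip-return {z} {t} ret o later l t<l l<e oₗ with l <? t + length z
  ... | yes l<t+z = ⊥-elim (gap ret o t<l l<t+z oₗ)
  ... | no l≮t+z  = later l (≮⇒≥ l≮t+z) l<e oₗ

  end-split : ∀ t (z y : Word) → t + length (z ++ y) ≡ t + length z + length y
  end-split t z y = trans (cong (t +_) (length-++ z)) (sym (+-assoc t (length z) (length y)))

  odd-walk : ∀ zs {t} → All Ret zs → OccursAt u (concat zs ++ w) t → OddThenEven (v t) zs →
             v (t + length (concat zs)) ≡ false
             × (∀ l → t ≤ l → l < t + length (concat zs) → Occ l → v l ≡ true)
  odd-walk []       {t} []           _ vₜ≡0 =
    trans (cong v (+-identityʳ t)) vₜ≡0 ,
    λ l t≤l l<t+0 _ → ⊥-elim (<⇒≱ (subst (l <_) (+-identityʳ t) l<t+0) t≤l)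
  odd-walk (z ∷ zs) {t} (ret ∷ rets) o (vₜ≡1 , odd) with return-step (concat zs) ret (concat-returning rets) o
  ... | oz , next , v-next with odd-walk zs rets next (subst (λ b → OddThenEven b zs) (sym v-next) odd)
  ...   | end≡0 , inside =
    subst (λ e → v e ≡ false) (sym (end-split t z (concat zs))) end≡0 , all-odd
    where
    all-odd : ∀ l → t ≤ l → l < t + length (z ++ concat zs) → Occ l → v l ≡ true
    all-odd l t≤l l<end oₗ with m≤n⇒m<n∨m≡n t≤l
    ... | inj₂ refl = vₜ≡1
    ... | inj₁ t<l  = skip-return ret oz inside l t<l (subst (l <_) (end-split t z (concat zs)) l<end) oₗ

  pattern⇒consecutive : ∀ {y t} → ReturnPattern y → v t ≡ false → OccursAt u (y ++ w) t →
                        Consecutive v x t (t + length y)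
  pattern⇒consecutive {t = t} (z , zs , ret , rets , refl , odd) vₜ≡0 o
    with return-step (concat zs) ret (concat-returning rets) o
  ... | oz , next , v-next
    with odd-walk zs rets next
           (subst (λ b → OddThenEven b zs) (sym (trans v-next (cong (_xor par z) vₜ≡0))) odd)
  ...   | end≡0 , inside =
    m<m+n t (≤-trans (nonempty ret) (subst (length z ≤_) (sym (length-++ z)) (m≤m+n _ _))) ,
    occurs-x vₜ≡0
      (occursAt-returning (z ++ concat zs) (returning-++ z _ (returning ret) (concat-returning rets)) o) ,
    occurs-x (subst (λ e → v e ≡ false) (sym end) end≡0) (occursAt-++ʳ (z ++ concat zs) w o) ,
    λ l t<l l<end oₗ → not-¬ (proj₁ (x-occurs oₗ))
      (skip-return ret oz inside l t<l (subst (l <_) end l<end) (proj₂ (x-occurs oₗ)))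
    where
    end : t + length (z ++ concat zs) ≡ t + length z + length (concat zs)
    end = end-split t z (concat zs)

  pattern-nonempty : ∀ {y} → ReturnPattern y → y ≢ []
  pattern-nonempty (z , zs , ret , _ , refl , _) =
    length-<⇒≢ (nonempty ret) ∘ sym ∘ ++-conicalˡ z (concat zs)

  consecutive-factor : ∀ {y t j} → ReturnPattern y → OccursAt u (y ++ w) t → Consecutive v x t j →
                       factor v t (j ∸ t) ≡ S⁻¹ y
  consecutive-factor {y} {t} pat o cons@(_ , oₜ , _) with pattern⇒consecutive pat (proj₁ (x-occurs oₜ)) o
  ... | cons-y@(_ , _ , o-end , _) with consecutive-unique cons cons-y
  ...   | refl = trans (cong (factor v t) (m+n∸m≡n t (length y)))
                       (factor≡S⁻¹ v y (occursAt-++ˡ y w o) (proj₁ (x-occurs o-end)))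

  record Candidate (y : Word) : Set where
    field
      shape      : ReturnPattern y
      occurrence : ∃ λ t → OccursAt u (y ++ w) t

  candidate⇒returnWord : ∀ {y} → Candidate y → IsReturnWord v x (S⁻¹ y)
  candidate⇒returnWord {y} cand
    with complement-occurrence complement-closed false (proj₂ (Candidate.occurrence cand))
  ... | t , o , vₜ≡0 = subst (IsReturnWord v x) (consecutive-factor pat o cons) (consecutive⇒returnWord cons)
    where
    pat : ReturnPattern y
    pat = Candidate.shape cand
    cons : Consecutive v x t (t + length y)
    cons = pattern⇒consecutive pat vₜ≡0 o

  OneOccursAt : Word → Word → Word → ℕ → Set
  OneOccursAt y₁ y₂ y₃ t = OccursAt u (y₁ ++ w) t ⊎ OccursAt u (y₂ ++ w) t ⊎ OccursAt u (y₃ ++ w) t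

  Covers : Word → Word → Word → Set
  Covers y₁ y₂ y₃ = ∀ i c d → c + d ≡ exponent i → OneOccursAt y₁ y₂ y₃ (slot i c)

  record Triple (y₁ y₂ y₃ : Word) : Set where
    field
      candidate₁ : Candidate y₁
      candidate₂ : Candidate y₂
      candidate₃ : Candidate y₃
      covers     : Covers y₁ y₂ y₃
      y₁≢y₂      : y₁ ≢ y₂
      y₁≢y₃      : y₁ ≢ y₃
      y₂≢y₃      : y₂ ≢ y₃

  triple⇒returnWords : ∀ {y₁ y₂ y₃ P} → Triple y₁ y₂ y₃ → P →
                       HasReturnWords v x (S⁻¹ y₁) (S⁻¹ y₂) (S⁻¹ y₃) P
  triple⇒returnWords {y₁} {y₂} {y₃} T p =
    S⁻¹-nonempty candidate₁ , S⁻¹-nonempty candidate₂ , S⁻¹-nonempty candidate₃ ,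
    y₁≢y₂ ∘ S⁻¹-injective y₁ y₂ , y₁≢y₃ ∘ S⁻¹-injective y₁ y₃ , y₂≢y₃ ∘ S⁻¹-injective y₂ y₃ ,
    (λ z → mk⇔ (to z) from) , p
    where
    open Triple T
    read : ∀ {y z i j} → Candidate y → OccursAt u (y ++ w) i → Consecutive v x i j →
           z ≡ factor v i (j ∸ i) → z ≡ S⁻¹ y
    read cand o cons z≡ = trans z≡ (consecutive-factor (Candidate.shape cand) o cons)
    S⁻¹-nonempty : ∀ {y} → Candidate y → S⁻¹ y ≢ []
    S⁻¹-nonempty {y} cand = pattern-nonempty (Candidate.shape cand) ∘ S⁻¹-injective y []
    to : ∀ z → IsReturnWord v x z → z ≡ S⁻¹ y₁ ⊎ z ≡ S⁻¹ y₂ ⊎ z ≡ S⁻¹ y₃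
    to z (i , j , i<j , oᵢ , oⱼ , gapᵢⱼ , z≡) with occurrence⇒slot (proj₂ (x-occurs oᵢ))
    ... | i' , c , d , c+d≡e , refl with covers i' c d c+d≡e
    ...   | inj₁ o        = inj₁ (read candidate₁ o (i<j , oᵢ , oⱼ , gapᵢⱼ) z≡)
    ...   | inj₂ (inj₁ o) = inj₂ (inj₁ (read candidate₂ o (i<j , oᵢ , oⱼ , gapᵢⱼ) z≡))
    ...   | inj₂ (inj₂ o) = inj₂ (inj₂ (read candidate₃ o (i<j , oᵢ , oⱼ , gapᵢⱼ) z≡))
    from : ∀ {z} → z ≡ S⁻¹ y₁ ⊎ z ≡ S⁻¹ y₂ ⊎ z ≡ S⁻¹ y₃ → IsReturnWord v x z
    from (inj₁ refl)        = candidate⇒returnWord candidate₁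
    from (inj₂ (inj₁ refl)) = candidate⇒returnWord candidate₂
    from (inj₂ (inj₂ refl)) = candidate⇒returnWord candidate₃

  not-both-stable : par r ≡ false → par s ≡ false → ⊥
  not-both-stable r-even s-even with complement-occurrence complement-closed true (occurs-at-start 0)
  ... | t , o , vₜ≡1 with occurrence⇒slot o
  ...   | i , c , d , c+d≡e , refl = not-¬ (v-slot i c d c+d≡e) vₜ≡1
    where
    v-start : ∀ i → v (start i) ≡ false
    v-start zero    = trans (cong v start-0) v₀≡0
    v-start (suc i) = begin
      v (start (suc i))                   ≡⟨ cong v (start-suc i) ⟩
      v (start i + length (block i))      ≡⟨ occursAt-Ss-parity v (block i) (block-occurs i) ⟩
      v (start i) xor par (block i)       ≡⟨ cong₂ _xor_ (v-start i) (trans (par-++ (r ^w exponent i) s)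
                                                           (cong₂ _xor_ (par-^w r (exponent i) r-even) s-even)) ⟩
      false                               ∎
      where open ≡-Reasoning
    v-slot : ∀ i c d → c + d ≡ exponent i → v (slot i c) ≡ false
    v-slot i c d c+d≡e = trans (occursAt-Ss-parity v (r ^w c) (powers-at-start i c d c+d≡e))
                               (cong₂ _xor_ (v-start i) (par-^w r c r-even))

  covers-by-tail : ∀ {y₁ y₂ y₃} →
    (∀ i → OneOccursAt y₁ y₂ y₃ (slot i (exponent i))) →
    (∀ i c → c + 1 ≡ exponent i → OneOccursAt y₁ y₂ y₃ (slot i c)) →
    (∀ i c d → c + suc (suc d) ≡ exponent i → OneOccursAt y₁ y₂ y₃ (slot i c)) →
    Covers y₁ y₂ y₃
  covers-by-tail {y₁} {y₂} {y₃} at-s _ _ i c zero c+0≡e =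
    subst (OneOccursAt y₁ y₂ y₃ ∘ slot i) (sym (trans (sym (+-identityʳ c)) c+0≡e)) (at-s i)
  covers-by-tail _ at-r _     i c (suc zero)    c+1≡e   = at-r i c c+1≡e
  covers-by-tail _ _    at-rr i c (suc (suc d)) c+2+d≡e = at-rr i c d c+2+d≡e

  first-slot : ∃ λ c → c + 1 ≡ exponent 0
  first-slot with exponent-suc 0
  ... | e , e₀≡1+e = e , trans (+-comm e 1) (sym e₀≡1+e)

  r++r-occurs : ∃ λ t → OccursAt u ((r ++ r) ++ w) t
  r++r-occurs with exponent-1+k-recurs sturmian
  ... | i , eᵢ₊₁≡1+k =
    slot (suc i) 0 , rr-at-slot (suc i) 0 (k ∸ 1) (trans (cong suc (m+[n∸m]≡n 1≤k)) (sym eᵢ₊₁≡1+k))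

  r++r-candidate : par r ≡ true → Candidate (r ++ r)
  r++r-candidate r-odd = record
    { shape      = r , r ∷ [] , r-ret , r-ret ∷ [] , cong (r ++_) (++-identityʳ r) , r-odd , xor-same (par r)
    ; occurrence = r++r-occurs }

  module StableUnstable (r-even : par r ≡ false) (s-odd : par s ≡ true) where

    odd-through-powers : ∀ j → OddThenEven true (replicate j r ++ s ∷ [])
    odd-through-powers zero    = refl , cong not s-odd
    odd-through-powers (suc j) =
      refl , subst (λ b → OddThenEven b (replicate j r ++ s ∷ [])) (sym (cong not r-even)) (odd-through-powers j)

    s-powers-s : ∀ j → (∃ λ i → exponent (suc i) ≡ j) → Candidate (s ++ r ^w j ++ s)
    s-powers-s j (i , eᵢ₊₁≡j) = record
      { shape      = s , replicate j r ++ s ∷ [] , s-ret , All.++⁺ (All.replicate⁺ j r-ret) (s-ret ∷ []) ,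
                     cong (s ++_) (trans (sym (concat-++ (replicate j r) (s ∷ [])))
                                         (cong (r ^w j ++_) (++-identityʳ s))) ,
                     subst (λ b → OddThenEven b (replicate j r ++ s ∷ [])) (sym s-odd) (odd-through-powers j)
      ; occurrence = slot i (exponent i) , s-powers-s-at-slot i eᵢ₊₁≡j }

    r<s++powers++s : ∀ j → 1 ≤ j → length r < length (s ++ r ^w j ++ s)
    r<s++powers++s (suc j) _ = begin-strict
      length r                             ≤⟨ m≤m+n (length r) _ ⟩
      length r + length (r ^w j)           ≡⟨ sym (length-++ r) ⟩
      length (r ^w suc j)                  ≤⟨ m≤m+n _ (length s) ⟩
      length (r ^w suc j) + length s       ≡⟨ sym (length-++ (r ^w suc j)) ⟩
      length (r ^w suc j ++ s)             <⟨ m<n+m _ (nonempty s-ret) ⟩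
      length s + length (r ^w suc j ++ s)  ≡⟨ sym (length-++ s) ⟩
      length (s ++ r ^w suc j ++ s)        ∎
      where open ≤-Reasoning

    triple : Triple r (s ++ r ^w suc k ++ s) (s ++ r ^w k ++ s)
    triple = record
      { candidate₁ = record
          { shape      = r , [] , r-ret , [] , ++-identityʳ r , r-even
          ; occurrence = slot 0 (proj₁ first-slot) , r-at-slot 0 _ 0 (proj₂ first-slot) }
      ; candidate₂ = s-powers-s (suc k) (exponent-1+k-recurs sturmian)
      ; candidate₃ = s-powers-s k (exponent-k-recurs sturmian)
      ; covers     = covers-by-tail s-block
                       (λ i c c+1≡e → inj₁ (r-at-slot i c 0 c+1≡e))
                       (λ i c d c+2+d≡e → inj₁ (r-at-slot i c (suc d) c+2+d≡e))
      ; y₁≢y₂      = length-<⇒≢ (r<s++powers++s (suc k) (s≤s z≤n))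
      ; y₁≢y₃      = length-<⇒≢ (r<s++powers++s k 1≤k)
      ; y₂≢y₃      = length-<⇒≢ (nonempty r-ret) ∘ sym ∘ ++-identityˡ-unique r ∘ sym
                     ∘ ++-cancelʳ s _ _ ∘ ++-cancelˡ s _ _
      }
      where
      s-block : ∀ i → OneOccursAt r (s ++ r ^w suc k ++ s) (s ++ r ^w k ++ s) (slot i (exponent i))
      s-block i with exponent-k (suc i)
      ... | inj₁ eᵢ₊₁≡k   = inj₂ (inj₂ (s-powers-s-at-slot i eᵢ₊₁≡k))
      ... | inj₂ eᵢ₊₁≡1+k = inj₂ (inj₁ (s-powers-s-at-slot i eᵢ₊₁≡1+k))

  module UnstableStable (r-odd : par r ≡ true) (s-even : par s ≡ false) where

    s<r++s++r : length s < length (r ++ s ++ r)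
    s<r++s++r = begin-strict
      length s                      <⟨ m<n+m (length s) (nonempty r-ret) ⟩
      length r + length s           ≤⟨ +-monoʳ-≤ (length r) (m≤m+n (length s) (length r)) ⟩
      length r + (length s + length r) ≡⟨ cong (length r +_) (sym (length-++ s)) ⟩
      length r + length (s ++ r)    ≡⟨ sym (length-++ r) ⟩
      length (r ++ s ++ r)          ∎
      where open ≤-Reasoning

    triple : Triple (r ++ r) (r ++ s ++ r) s
    triple = record
      { candidate₁ = r++r-candidate r-odd
      ; candidate₂ = record
          { shape      = r , s ∷ r ∷ [] , r-ret , s-ret ∷ r-ret ∷ [] ,
                         cong (λ y → r ++ s ++ y) (++-identityʳ r) ,
                         r-odd , cong₂ _xor_ r-odd s-even , cong₂ _xor_ (cong₂ _xor_ r-odd s-even) r-odd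
          ; occurrence = slot 0 (proj₁ first-slot) , rsr-at-slot 0 _ (proj₂ first-slot) }
      ; candidate₃ = record
          { shape      = s , [] , s-ret , [] , ++-identityʳ s , s-even
          ; occurrence = slot 0 (exponent 0) , s-at-slot 0 }
      ; covers     = covers-by-tail (λ i → inj₂ (inj₂ (s-at-slot i)))
                                    (λ i c c+1≡e → inj₂ (inj₁ (rsr-at-slot i c c+1≡e)))
                                    (λ i c d c+2+d≡e → inj₁ (rr-at-slot i c d c+2+d≡e))
      ; y₁≢y₂      = length-<⇒≢ (nonempty s-ret) ∘ sym ∘ ++-identityˡ-unique s ∘ ++-cancelˡ r _ _
      ; y₁≢y₃      = s≢r++r r≢s ∘ sym
      ; y₂≢y₃      = length-<⇒≢ s<r++s++r ∘ sym
      }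

  module UnstableUnstable (r-odd : par r ≡ true) (s-odd : par s ≡ true) where

    triple : Triple (r ++ r) (r ++ s) (s ++ r)
    triple = record
      { candidate₁ = r++r-candidate r-odd
      ; candidate₂ = record
          { shape      = r , s ∷ [] , r-ret , s-ret ∷ [] , cong (r ++_) (++-identityʳ s) ,
                         r-odd , cong₂ _xor_ r-odd s-odd
          ; occurrence = slot 0 (proj₁ first-slot) , rs-at-slot 0 _ (proj₂ first-slot) }
      ; candidate₃ = record
          { shape      = s , r ∷ [] , s-ret , r-ret ∷ [] , cong (s ++_) (++-identityʳ r) ,
                         s-odd , cong₂ _xor_ s-odd r-odd
          ; occurrence = slot 0 (exponent 0) , sr-at-slot 0 }
      ; covers     = covers-by-tail (λ i → inj₂ (inj₂ (sr-at-slot i)))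
                                    (λ i c c+1≡e → inj₂ (inj₁ (rs-at-slot i c c+1≡e)))
                                    (λ i c d c+2+d≡e → inj₁ (rr-at-slot i c d c+2+d≡e))
      ; y₁≢y₂      = r≢s ∘ ++-cancelˡ r _ _
      ; y₁≢y₃      = r≢s ∘ ++-cancelʳ r _ _
      ; y₂≢y₃      = r++s≢s++r r≢s
      }

  S-images : Word → Word → Word → Set
  S-images A B C =
      (Stable r → Unstable s →
          Sw (A ++ false ∷ []) ≡ r
          × Sw (B ++ false ∷ []) ≡ s ++ (r ^w suc k) ++ s
          × Sw (C ++ false ∷ []) ≡ s ++ (r ^w k) ++ s)
      × (Unstable r → Stable s →
          Sw (A ++ false ∷ []) ≡ r ++ r
          × Sw (B ++ false ∷ []) ≡ r ++ s ++ r
          × Sw (C ++ false ∷ []) ≡ s)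
      × (Unstable r → Unstable s →
          Sw (A ++ false ∷ []) ≡ r ++ r
          × Sw (B ++ false ∷ []) ≡ r ++ s
          × Sw (C ++ false ∷ []) ≡ s ++ r)

  conclusion : ∃ λ A → ∃ λ B → ∃ λ C → HasReturnWords v x A B C (S-images A B C)
  conclusion with par r in r-par | par s in s-par
  ... | false | false = ⊥-elim (not-both-stable r-par s-par)
  ... | false | true  = _ , _ , _ , triple⇒returnWords (StableUnstable.triple r-par s-par)
      ((λ _ _ → S⁻¹-spec _ , S⁻¹-spec _ , S⁻¹-spec _) ,
       (λ r-unstable _ → ⊥-elim (Unstable⇒par≢false r r-unstable r-par)) ,
       (λ r-unstable _ → ⊥-elim (Unstable⇒par≢false r r-unstable r-par)))
  ... | true  | false = _ , _ , _ , triple⇒returnWords (UnstableStable.triple r-par s-par)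
      ((λ r-stable _ → ⊥-elim (Stable⇒par≢true r r-stable r-par)) ,
       (λ _ _ → S⁻¹-spec _ , S⁻¹-spec _ , S⁻¹-spec _) ,
       (λ _ s-unstable → ⊥-elim (Unstable⇒par≢false s s-unstable s-par)))
  ... | true  | true  = _ , _ , _ , triple⇒returnWords (UnstableUnstable.triple r-par s-par)
      ((λ r-stable _ → ⊥-elim (Stable⇒par≢true r r-stable r-par)) ,
       (λ _ s-stable → ⊥-elim (Stable⇒par≢true s s-stable s-par)) ,
       (λ _ _ → S⁻¹-spec _ , S⁻¹-spec _ , S⁻¹-spec _))

theorem3p10 :
  (v : Seq) → CSRote v → v 0 ≡ false → StandardSturmian (Ss v) →
  (x : Word) → x ≢ [] → IsPrefix x v →
  (r s : Word) (k : ℕ) →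
  r ≢ s →
  (∀ z → IsReturnWord (Ss v) (Sw x) z ⇔ (z ≡ r ⊎ z ≡ s)) →
  1 ≤ k →
  BlockDecomposition (Ss v) r s k →
  ∃ λ A → ∃ λ B → ∃ λ C →
    A ≢ [] × B ≢ [] × C ≢ [] × A ≢ B × A ≢ C × B ≢ C
    × (∀ z → IsReturnWord v x z ⇔ (z ≡ A ⊎ z ≡ B ⊎ z ≡ C))
    × (Stable r → Unstable s →
        Sw (A ++ false ∷ []) ≡ r
        × Sw (B ++ false ∷ []) ≡ s ++ (r ^w suc k) ++ s
        × Sw (C ++ false ∷ []) ≡ s ++ (r ^w k) ++ s)
    × (Unstable r → Stable s →
        Sw (A ++ false ∷ []) ≡ r ++ r
        × Sw (B ++ false ∷ []) ≡ r ++ s ++ r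
        × Sw (C ++ false ∷ []) ≡ s)
    × (Unstable r → Unstable s →
        Sw (A ++ false ∷ []) ≡ r ++ r
        × Sw (B ++ false ∷ []) ≡ r ++ s
        × Sw (C ++ false ∷ []) ≡ s ++ r)
theorem3p10 v rote v₀≡0 sst []          x≢[] _  r s k r≢s returns 1≤k bd = ⊥-elim (x≢[] refl)
theorem3p10 v rote v₀≡0 sst (true ∷ x') _    px r s k r≢s returns 1≤k bd =
  ⊥-elim (not-¬ v₀≡0 (proj₁ (∷-injective px)))
theorem3p10 v (_ , closed) v₀≡0 (sturmian , _) (false ∷ x') _ _ r s k r≢s returns 1≤k bd =
  LiftToRote.conclusion v closed v₀≡0 sturmian x' r s k r≢s returns 1≤k (blockDecomposition⇒blocks bd)
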